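{- Let $P$ be a finite poset. Then the automorphism group $\mathrm{Aut}(P)$ is isomorphic to a subgroup of the group $\mathrm{Aut}(G_P)\cap O_P$, where $\mathrm{Aut}(G_P)$ is the automorphism group of the graph $G_P$.
   Context: A chain of a poset is a subset any two of whose elements are comparable. A homogeneous chain decomposition (HCD) of a finite poset $(P,\leq)$ is a collection of mutually disjoint chains $C_1,\dots,C_m$ with $\bigcup_i C_i=P$ such that whenever some element of $C_i$ and some element of $C_j$ are comparable, every element of $C_i$ is comparable with every element of $C_j$ (then $C_i,C_j$ are called comparable). Among all HCDs there is a unique one with the minimum number of chains, the MHCD $\mathcal{C}=\{C_1,\dots,C_m\}$. $G_P$ is the simple graph with vertex set $\mathcal{C}$ in which distinct $C_i,C_j$ are adjacent iff they are comparable. Partition $\mathcal{C}$ into classes $S_0,\dots,S_{t-1}$ of chains of equal size (chains in the same class have the same number of elements, chains in different classes have different numbers of elements). $O_P$ is the group of permutations of $V(G_P)$ generated by all permutations of $V(G_P)$ each of whose cycles consists of elements from a single class $S_i$. $\mathrm{Aut}(P)$ is the automorphism group of the poset $P$. -}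

module Defs where

open import Data.Nat using (ℕ) renaming (_≤_ to _≤ℕ_)
open import Data.Fin using (Fin; _≟_)
open import Data.Fin.Permutation using (Permutation′; _⟨$⟩ʳ_; _∘ₚ_)
open import Data.List using (length; filter; allFin)
open import Data.Product using (Σ; ∃; _×_; _,_; proj₁; proj₂)
open import Data.Sum using (_⊎_)
open import Relation.Nullary using (¬_)
open import Relation.Binary.PropositionalEquality using (_≡_)
open import Relation.Binary.Structures using (IsPartialOrder)

-- A finite poset: carrier Fin n (every finite poset is isomorphic to one of these),
-- with a partial order _≼_ (antisymmetric up to propositional equality).
record FinPoset : Set₁ where
  field
    n      : ℕ
    _≼_    : Fin n → Fin n → Set
    isPO   : IsPartialOrder _≡_ _≼_

module _ (P : FinPoset) where
  open FinPoset P

  Comparable : Fin n → Fin n → Set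
  Comparable x y = (x ≼ y) ⊎ (y ≼ x)

  -- A decomposition into m chains C_0,…,C_{m-1} is given by c : Fin n → Fin m,
  -- C_i = { x | c x ≡ i }.  Being a function, the C_i are disjoint and cover P.
  record IsHCD (m : ℕ) (c : Fin n → Fin m) : Set where
    field
      nonempty    : ∀ (i : Fin m) → ∃ λ x → c x ≡ i
      chain       : ∀ (x y : Fin n) → c x ≡ c y → Comparable x y
      homogeneous : ∀ (x y x′ y′ : Fin n) → Comparable x y →
                    c x′ ≡ c x → c y′ ≡ c y → Comparable x′ y′

  IsMHCD : (m : ℕ) → (Fin n → Fin m) → Set
  IsMHCD m c = IsHCD m c × (∀ (m′ : ℕ) (c′ : Fin n → Fin m′) → IsHCD m′ c′ → m ≤ℕ m′)

  -- Edge relation of the graph G_P (vertices = chains Fin m)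
  Adjacent : {m : ℕ} → (Fin n → Fin m) → Fin m → Fin m → Set
  Adjacent c i j = ¬ (i ≡ j) × (∃ λ x → ∃ λ y → c x ≡ i × c y ≡ j × Comparable x y)

  chainSize : {m : ℕ} → (Fin n → Fin m) → Fin m → ℕ
  chainSize c i = length (filter (λ x → c x ≟ i) (allFin n))

  IsGraphAut : {m : ℕ} → (Fin n → Fin m) → Permutation′ m → Set
  IsGraphAut {m} c σ = ∀ (i j : Fin m) →
    (Adjacent c i j → Adjacent c (σ ⟨$⟩ʳ i) (σ ⟨$⟩ʳ j)) ×
    (Adjacent c (σ ⟨$⟩ʳ i) (σ ⟨$⟩ʳ j) → Adjacent c i j)

  -- σ ∈ O_P: every cycle of σ stays inside one class S_k of chains of equal size,
  -- i.e. σ maps every chain to a chain of the same size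
  InO : {m : ℕ} → (Fin n → Fin m) → Permutation′ m → Set
  InO {m} c σ = ∀ (i : Fin m) → chainSize c (σ ⟨$⟩ʳ i) ≡ chainSize c i

  record PosetAut : Set where
    field
      perm     : Permutation′ n
      preserve : ∀ (x y : Fin n) → x ≼ y → (perm ⟨$⟩ʳ x) ≼ (perm ⟨$⟩ʳ y)
      reflect  : ∀ (x y : Fin n) → (perm ⟨$⟩ʳ x) ≼ (perm ⟨$⟩ʳ y) → x ≼ y

  open PosetAut

  -- group operation of Aut(P): (f ∘ᴬ g) x = f (g x)
  _∘ᴬ_ : PosetAut → PosetAut → PosetAut
  perm (f ∘ᴬ g) = perm g ∘ₚ perm f
  preserve (f ∘ᴬ g) x y p = preserve f _ _ (preserve g x y p)
  reflect (f ∘ᴬ g) x y p = reflect g x y (reflect f _ _ p)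

  _≈ᴬ_ : PosetAut → PosetAut → Set
  f ≈ᴬ g = ∀ (x : Fin n) → perm f ⟨$⟩ʳ x ≡ perm g ⟨$⟩ʳ x

  -- Aut(P) is isomorphic to a subgroup of Aut(G_P) ∩ O_P:
  -- there is an injective group homomorphism Aut(P) → Aut(G_P) ∩ O_P
  EmbedsInAutGO : (m : ℕ) → (Fin n → Fin m) → Set
  EmbedsInAutGO m c = Σ (PosetAut → Permutation′ m) λ φ →
    (∀ (f : PosetAut) → IsGraphAut c (φ f) × InO c (φ f)) ×
    (∀ (f g : PosetAut) (i : Fin m) → φ (f ∘ᴬ g) ⟨$⟩ʳ i ≡ φ f ⟨$⟩ʳ (φ g ⟨$⟩ʳ i)) ×
    (∀ (f g : PosetAut) → (∀ (i : Fin m) → φ f ⟨$⟩ʳ i ≡ φ g ⟨$⟩ʳ i) → f ≈ᴬ g)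

{-# OPTIONS --safe #-}
module Submission where

-- Call x and y twins when they are comparable to exactly the same elements.  The chains
-- of any HCD consist of pairwise twins, and in the minimum HCD conversely twins share a
-- chain, since otherwise their two chains could be merged into an HCD with fewer chains.
-- Automorphisms preserve twinship, so each automorphism f permutes the chains; the
-- induced permutation preserves comparability of chains and chain sizes, and f ↦ σ_f is
-- a homomorphism.  It is injective: if σ_f = σ_g then f x and g x always share a chain,
-- hence are comparable, and an automorphism h moving every x to an element comparable
-- with x is the identity (by well-founded induction: h x < x would give h (h x) = h x).

open import Defs
open import Data.Bool.Base using (Bool; true; false; if_then_else_)
open import Data.Fin.Base using (Fin; zero; suc; punchIn; punchOut)
open import Data.Fin.Induction using (po-wellFounded)
open import Data.Fin.Permutation
  using (Permutation′; _⟨$⟩ʳ_; _⟨$⟩ˡ_; permutation; flip; inverseˡ; inverseʳ)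
open import Data.Fin.Properties using (_≟_; ¬Fin0; punchOut-injective; punchOut-punchIn; punchInᵢ≢i)
open import Data.List.Base using (length; filter; tabulate; allFin)
open import Data.Nat.Base using (ℕ; zero; suc)
open import Data.Nat.Properties using (n≮n; +-0-commutativeMonoid)
open import Data.Product using (∃; _×_; _,_; proj₁; proj₂)
open import Data.Sum using (_⊎_; inj₁; inj₂; swap) renaming (map to ⊎-map)
open import Function.Base using (id; _∘_; _on_)
open import Function.Bundles using (_⇔_; mk⇔; Equivalence; Injection)
open import Function.Construct.Composition using (_⇔-∘_)
open import Function.Construct.Identity using (⇔-id)
open import Function.Construct.Symmetry using (⇔-sym)
open import Function.Properties.Inverse using (↔⇒↣)
open import Induction.WellFounded using (Acc; acc)
open import Relation.Binary.Core using (_Preserves_⟶_)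
open import Relation.Binary.PropositionalEquality
  using (_≡_; _≢_; refl; sym; trans; cong; subst; subst₂; module ≡-Reasoning)
open import Relation.Binary.Structures using (IsPartialOrder)
open import Relation.Nullary using (yes; no; does; contradiction)
open import Relation.Nullary.Decidable using (does-⇔)
open import Relation.Unary using (Pred; Decidable)
import Relation.Binary.Construct.NonStrictToStrict as NonStrictToStrict
open import Algebra.Properties.CommutativeMonoid.Sum +-0-commutativeMonoid
  using (sum; sum-permute; sum-cong-≗)

open ≡-Reasoning

indicator : Bool → ℕ
indicator b = if b then 1 else 0

length-filter-tabulate : ∀ {a p} {A : Set a} {P : Pred A p} (P? : Decidable P) {k} (g : Fin k → A) →
  length (filter P? (tabulate g)) ≡ sum (λ i → indicator (does (P? (g i))))
length-filter-tabulate P? {zero} g = refl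
length-filter-tabulate P? {suc k} g with does (P? (g zero))
... | true  = cong suc (length-filter-tabulate P? (g ∘ suc))
... | false = length-filter-tabulate P? (g ∘ suc)

length-filter-allFin-permute : ∀ {n p q} {P : Pred (Fin n) p} {Q : Pred (Fin n) q}
  (P? : Decidable P) (Q? : Decidable Q) (π : Permutation′ n) → (∀ x → P (π ⟨$⟩ʳ x) ⇔ Q x) →
  length (filter P? (allFin n)) ≡ length (filter Q? (allFin n))
length-filter-allFin-permute {n} P? Q? π P∘π⇔Q = begin
  length (filter P? (allFin n))  ≡⟨ length-filter-tabulate P? id ⟩
  sum χP                         ≡⟨ sum-permute χP π ⟩
  sum (χP ∘ (π ⟨$⟩ʳ_))           ≡⟨ sum-cong-≗ χP∘π≗χQ ⟩
  sum χQ                         ≡⟨ length-filter-tabulate Q? id ⟨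
  length (filter Q? (allFin n))  ∎
  where
    χP χQ : Fin n → ℕ
    χP x = indicator (does (P? x))
    χQ x = indicator (does (Q? x))
    χP∘π≗χQ : ∀ x → χP (π ⟨$⟩ʳ x) ≡ χQ x
    χP∘π≗χQ x = cong indicator (does-⇔ (P∘π⇔Q x) (P? (π ⟨$⟩ʳ x)) (Q? x))

module Fuse {m} {i j : Fin (suc m)} (i≢j : i ≢ j) where

  redirect : Fin (suc m) → Fin (suc m)
  redirect k with k ≟ j
  ... | yes _ = i
  ... | no _  = k

  redirect-cases : ∀ k → (k ≡ j × redirect k ≡ i) ⊎ redirect k ≡ k
  redirect-cases k with k ≟ j
  ... | yes k≡j = inj₁ (k≡j , refl)
  ... | no _    = inj₂ refl

  redirect-≢ : ∀ k → j ≢ redirect k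
  redirect-≢ k with k ≟ j
  ... | yes _   = i≢j ∘ sym
  ... | no k≢j  = k≢j ∘ sym

  -- identifies j with i and closes the resulting gap
  fuse : Fin (suc m) → Fin m
  fuse k = punchOut (redirect-≢ k)

  fuse-redirect : ∀ k l → fuse k ≡ fuse l → redirect k ≡ redirect l
  fuse-redirect k l = punchOut-injective (redirect-≢ k) (redirect-≢ l)

  fuse-punchIn : ∀ l → fuse (punchIn j l) ≡ l
  fuse-punchIn l with punchIn j l ≟ j
  ... | yes e = contradiction e (punchInᵢ≢i j l)
  ... | no _  = punchOut-punchIn j

module _ {n m} (c : Fin n → Fin m) (c-surjective : ∀ i → ∃ λ x → c x ≡ i) where

  induced : (Fin n → Fin n) → Fin m → Fin m
  induced π i = c (π (proj₁ (c-surjective i)))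

  induced-commutes : ∀ {π} → π Preserves (_≡_ on c) ⟶ (_≡_ on c) →
                     ∀ x → induced π (c x) ≡ c (π x)
  induced-commutes π-resp x = π-resp (proj₂ (c-surjective (c x)))

  inducedPermutation : (π : Permutation′ n) →
                       (π ⟨$⟩ʳ_) Preserves (_≡_ on c) ⟶ (_≡_ on c) →
                       (π ⟨$⟩ˡ_) Preserves (_≡_ on c) ⟶ (_≡_ on c) → Permutation′ m
  inducedPermutation π to-resp from-resp =
    permutation (induced (π ⟨$⟩ʳ_)) (induced (π ⟨$⟩ˡ_))
                (cancel to-resp (inverseʳ π)) (cancel from-resp (inverseˡ π))
    where
      cancel : ∀ {f g} → f Preserves (_≡_ on c) ⟶ (_≡_ on c) → (∀ {x} → f (g x) ≡ x) →
               ∀ i → induced f (induced g i) ≡ i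
      cancel {f} {g} f-resp f∘g≗id i = begin
        induced f (c (g x))  ≡⟨ induced-commutes f-resp (g x) ⟩
        c (f (g x))          ≡⟨ cong c f∘g≗id ⟩
        c x                  ≡⟨ proj₂ (c-surjective i) ⟩
        i                    ∎
        where
          x : Fin n
          x = proj₁ (c-surjective i)

module _ (P : FinPoset) where
  open FinPoset P
  open IsPartialOrder isPO using () renaming (refl to ≼-refl)
  open IsHCD
  open PosetAut
  open Equivalence using (to; from)

  Twins : Fin n → Fin n → Set
  Twins x y = ∀ z → Comparable P x z ⇔ Comparable P y z

  twins-refl : ∀ {x} → Twins x x
  twins-refl z = ⇔-id _

  twins-sym : ∀ {x y} → Twins x y → Twins y x
  twins-sym x≈y z = ⇔-sym (x≈y z)

  twins-trans : ∀ {x y w} → Twins x y → Twins y w → Twins x w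
  twins-trans x≈y y≈w z = y≈w z ⇔-∘ x≈y z

  twins⇒comparable : ∀ {x y} → Twins x y → Comparable P x y
  twins⇒comparable {x} x≈y = swap (to (x≈y x) (inj₁ ≼-refl))

  sameChain⇒twins : ∀ {k} {c : Fin n → Fin k} → IsHCD P k c →
                    ∀ {x y} → c x ≡ c y → Twins x y
  sameChain⇒twins hcd {x} {y} cx≡cy z =
    mk⇔ (λ x~z → homogeneous hcd x z y z x~z (sym cx≡cy) refl)
        (λ y~z → homogeneous hcd y z x z y~z cx≡cy refl)

  twinClasses⇒hcd : ∀ {k} (d : Fin n → Fin k) → (∀ i → ∃ λ x → d x ≡ i) →
                    (∀ {x y} → d x ≡ d y → Twins x y) → IsHCD P k d
  twinClasses⇒hcd d d-surjective twins = record
    { nonempty    = d-surjective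
    ; chain       = λ x y dx≡dy → twins⇒comparable (twins dx≡dy)
    ; homogeneous = λ x y x′ y′ x~y dx′≡dx dy′≡dy →
        swap (from (twins dy′≡dy x′) (swap (from (twins dx′≡dx y) x~y)))
    }

  module _ {m} {c : Fin n → Fin (suc m)} (hcd : IsHCD P (suc m) c)
           {a b} (a≈b : Twins a b) (ca≢cb : c a ≢ c b) where
    open Fuse ca≢cb

    twin-in-redirected-chain : ∀ x → ∃ λ w → c w ≡ redirect (c x) × Twins x w
    twin-in-redirected-chain x with redirect-cases (c x)
    ... | inj₁ (cx≡cb , r≡ca) =
      a , sym r≡ca , twins-trans (sameChain⇒twins hcd cx≡cb) (twins-sym a≈b)
    ... | inj₂ r≡cx           = x , sym r≡cx , twins-refl

    fused-hcd : IsHCD P m (fuse ∘ c)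
    fused-hcd = twinClasses⇒hcd (fuse ∘ c) fused-surjective fused-twins
      where
        fused-surjective : ∀ l → ∃ λ x → fuse (c x) ≡ l
        fused-surjective l with nonempty hcd (punchIn (c b) l)
        ... | x , cx≡ = x , trans (cong fuse cx≡) (fuse-punchIn l)

        fused-twins : ∀ {x y} → fuse (c x) ≡ fuse (c y) → Twins x y
        fused-twins {x} {y} e with twin-in-redirected-chain x | twin-in-redirected-chain y
        ... | wx , cwx , x≈wx | wy , cwy , y≈wy =
          twins-trans x≈wx (twins-trans (sameChain⇒twins hcd cwx≡cwy) (twins-sym y≈wy))
          where
            cwx≡cwy : c wx ≡ c wy
            cwx≡cwy = trans cwx (trans (fuse-redirect (c x) (c y) e) (sym cwy))

  mhcd-twins⇒sameChain : ∀ {m} {c : Fin n → Fin m} → IsMHCD P m c →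
                         ∀ {x y} → Twins x y → c x ≡ c y
  mhcd-twins⇒sameChain {zero}  {c} _ {x} _ = contradiction (c x) ¬Fin0
  mhcd-twins⇒sameChain {suc m} {c} (hcd , minimal) {x} {y} x≈y with c x ≟ c y
  ... | yes cx≡cy = cx≡cy
  ... | no cx≢cy  = contradiction (minimal m _ (fused-hcd hcd x≈y cx≢cy)) (n≮n m)

  infixr 9 _·_
  _·_ : PosetAut P → Fin n → Fin n
  f · x = perm f ⟨$⟩ʳ x

  aut⁻¹ : PosetAut P → PosetAut P
  perm     (aut⁻¹ f) = flip (perm f)
  preserve (aut⁻¹ f) x y x≼y =
    reflect f _ _ (subst₂ _≼_ (sym (inverseʳ (perm f))) (sym (inverseʳ (perm f))) x≼y)
  reflect  (aut⁻¹ f) x y f⁻¹x≼f⁻¹y =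
    subst₂ _≼_ (inverseʳ (perm f)) (inverseʳ (perm f)) (preserve f _ _ f⁻¹x≼f⁻¹y)

  ·-inverseʳ : ∀ f {x} → f · aut⁻¹ f · x ≡ x
  ·-inverseʳ f = inverseʳ (perm f)

  ·-injective : ∀ f {x y} → f · x ≡ f · y → x ≡ y
  ·-injective f = Injection.injective (↔⇒↣ (perm f))

  comparable-preserved : ∀ f {x y} → Comparable P x y → Comparable P (f · x) (f · y)
  comparable-preserved f = ⊎-map (preserve f _ _) (preserve f _ _)

  comparable-reflected : ∀ f {x y} → Comparable P (f · x) (f · y) → Comparable P x y
  comparable-reflected f = ⊎-map (reflect f _ _) (reflect f _ _)

  comparable-transpose : ∀ f {x z} → Comparable P (f · x) z ⇔ Comparable P x (aut⁻¹ f · z)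
  comparable-transpose f {x} =
    mk⇔ (λ fx~z → comparable-reflected f (subst (Comparable P (f · x)) (sym (·-inverseʳ f)) fx~z))
        (λ x~f⁻¹z → subst (Comparable P (f · x)) (·-inverseʳ f) (comparable-preserved f x~f⁻¹z))

  twins-preserved : ∀ f {x y} → Twins x y → Twins (f · x) (f · y)
  twins-preserved f x≈y z =
    ⇔-sym (comparable-transpose f) ⇔-∘ (x≈y (aut⁻¹ f · z) ⇔-∘ comparable-transpose f)

  _<_ : Fin n → Fin n → Set
  _<_ = NonStrictToStrict._<_ _≡_ _≼_

  comparable-to-id⇒id : ∀ h → (∀ x → Comparable P (h · x) x) → ∀ x → h · x ≡ x
  comparable-to-id⇒id h h~id x = fixed x (po-wellFounded isPO x)
    where
      fixed : ∀ x → Acc _<_ x → h · x ≡ x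
      fixed x (acc below) with h · x ≟ x | h~id x
      ... | yes hx≡x | _         = hx≡x
      ... | no hx≢x  | inj₁ hx≼x =
        contradiction (·-injective h (fixed (h · x) (below (hx≼x , hx≢x)))) hx≢x
      ... | no hx≢x  | inj₂ x≼hx =
        contradiction (trans (sym (fixed y (below (y≼x , y≢x)))) hy≡x) y≢x
        where
          y : Fin n
          y = aut⁻¹ h · x
          hy≡x : h · y ≡ x
          hy≡x = ·-inverseʳ h
          y≼x : y ≼ x
          y≼x = reflect h y x (subst (_≼ (h · x)) (sym hy≡x) x≼hx)
          y≢x : y ≢ x
          y≢x y≡x = hx≢x (trans (cong (h ·_) (sym y≡x)) hy≡x)

  pointwise-comparable⇒≈ᴬ : ∀ f g → (∀ x → Comparable P (f · x) (g · x)) → _≈ᴬ_ P f g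
  pointwise-comparable⇒≈ᴬ f g fx~gx x = begin
    f · x                    ≡⟨ ·-inverseʳ g ⟨
    g · aut⁻¹ g · f · x      ≡⟨ cong (g ·_) (comparable-to-id⇒id g⁻¹f g⁻¹f~id x) ⟩
    g · x                    ∎
    where
      g⁻¹f : PosetAut P
      g⁻¹f = _∘ᴬ_ P (aut⁻¹ g) f
      g⁻¹f~id : ∀ x → Comparable P (aut⁻¹ g · f · x) x
      g⁻¹f~id x = swap (to (comparable-transpose g) (swap (fx~gx x)))

  module _ {m} {c : Fin n → Fin m} (mhcd : IsMHCD P m c) where
    private
      hcd : IsHCD P m c
      hcd = proj₁ mhcd

    chains-preserved : ∀ f → (f ·_) Preserves (_≡_ on c) ⟶ (_≡_ on c)
    chains-preserved f = mhcd-twins⇒sameChain mhcd ∘ twins-preserved f ∘ sameChain⇒twins hcd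

    chainPermutation : PosetAut P → Permutation′ m
    chainPermutation f =
      inducedPermutation c (nonempty hcd) (perm f) (chains-preserved f) (chains-preserved (aut⁻¹ f))

    chainPermutation-commutes : ∀ f x → chainPermutation f ⟨$⟩ʳ c x ≡ c (f · x)
    chainPermutation-commutes f = induced-commutes c (nonempty hcd) (chains-preserved f)

    chainPermutation-injective : ∀ f {i j} →
                                 chainPermutation f ⟨$⟩ʳ i ≡ chainPermutation f ⟨$⟩ʳ j → i ≡ j
    chainPermutation-injective f = Injection.injective (↔⇒↣ (chainPermutation f))

    adjacent-preserved : ∀ f {i j} → Adjacent P c i j →
                         Adjacent P c (chainPermutation f ⟨$⟩ʳ i) (chainPermutation f ⟨$⟩ʳ j)
    adjacent-preserved f (i≢j , x , y , refl , refl , x~y) =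
      i≢j ∘ chainPermutation-injective f , f · x , f · y ,
      sym (chainPermutation-commutes f x) , sym (chainPermutation-commutes f y) ,
      comparable-preserved f x~y

    -- the inverse of chainPermutation f is, definitionally, chainPermutation (aut⁻¹ f)
    chainPermutation-isGraphAut : ∀ f → IsGraphAut P c (chainPermutation f)
    chainPermutation-isGraphAut f i j =
      adjacent-preserved f ,
      λ σi∼σj →
        subst₂ (Adjacent P c) (inverseˡ σ) (inverseˡ σ) (adjacent-preserved (aut⁻¹ f) σi∼σj)
      where
        σ : Permutation′ m
        σ = chainPermutation f

    chainPermutation-inO : ∀ f → InO P c (chainPermutation f)
    chainPermutation-inO f i =
      length-filter-allFin-permute (λ x → c x ≟ σ ⟨$⟩ʳ i) (λ x → c x ≟ i) (perm f)
                                   image-in-σi⇔in-i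
      where
        σ : Permutation′ m
        σ = chainPermutation f
        image-in-σi⇔in-i : ∀ x → c (f · x) ≡ σ ⟨$⟩ʳ i ⇔ c x ≡ i
        image-in-σi⇔in-i x =
          mk⇔ (λ cfx≡σi →
                 chainPermutation-injective f (trans (chainPermutation-commutes f x) cfx≡σi))
              (λ cx≡i → trans (sym (chainPermutation-commutes f x)) (cong (σ ⟨$⟩ʳ_) cx≡i))

    agree-on-chains : ∀ {a} {A : Set a} (F G : Fin m → A) →
                      (∀ x → F (c x) ≡ G (c x)) → ∀ i → F i ≡ G i
    agree-on-chains F G F∘c≗G∘c i =
      subst (λ i → F i ≡ G i) (proj₂ (nonempty hcd i)) (F∘c≗G∘c _)

    chainPermutation-∘ : ∀ f g i → chainPermutation (_∘ᴬ_ P f g) ⟨$⟩ʳ i ≡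
                                   chainPermutation f ⟨$⟩ʳ (chainPermutation g ⟨$⟩ʳ i)
    chainPermutation-∘ f g =
      agree-on-chains (σ (_∘ᴬ_ P f g) ⟨$⟩ʳ_) (λ i → σ f ⟨$⟩ʳ (σ g ⟨$⟩ʳ i)) λ x → begin
      σ (_∘ᴬ_ P f g) ⟨$⟩ʳ c x     ≡⟨ chainPermutation-commutes (_∘ᴬ_ P f g) x ⟩
      c (f · g · x)              ≡⟨ chainPermutation-commutes f (g · x) ⟨
      σ f ⟨$⟩ʳ c (g · x)          ≡⟨ cong (σ f ⟨$⟩ʳ_) (chainPermutation-commutes g x) ⟨
      σ f ⟨$⟩ʳ (σ g ⟨$⟩ʳ c x)     ∎
      where
        σ : PosetAut P → Permutation′ m
        σ = chainPermutation

    chainPermutation-faithful : ∀ f g →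
                                (∀ i → chainPermutation f ⟨$⟩ʳ i ≡ chainPermutation g ⟨$⟩ʳ i) →
                                _≈ᴬ_ P f g
    chainPermutation-faithful f g σf≗σg = pointwise-comparable⇒≈ᴬ f g λ x → chain hcd _ _ (begin
      c (f · x)                    ≡⟨ chainPermutation-commutes f x ⟨
      chainPermutation f ⟨$⟩ʳ c x  ≡⟨ σf≗σg (c x) ⟩
      chainPermutation g ⟨$⟩ʳ c x  ≡⟨ chainPermutation-commutes g x ⟩
      c (g · x)                    ∎)

corollary3p4 : (P : FinPoset) (m : ℕ) (c : Fin (FinPoset.n P) → Fin m) →
               IsMHCD P m c → EmbedsInAutGO P m c
corollary3p4 P m c mhcd =
  chainPermutation P mhcd ,
  (λ f → chainPermutation-isGraphAut P mhcd f , chainPermutation-inO P mhcd f) ,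
  chainPermutation-∘ P mhcd ,
  chainPermutation-faithful P mhcd
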